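{- Let $t\ge 2$ and let $p=p_1p_2\cdots p_{n-1}$ be a permutation of $\{1,\dots,n-1\}$ that is sortable by $t-1$ stacks in series. Then any permutation $p'$ of $\{1,\dots,n\}$ obtained by inserting $n$ into any position of $p$ is sortable by $t$ stacks in series.
   Context: Sorting with $s$ stacks in series: the positions, ordered from right to left, are the input, stack $1$, ..., stack $s$, and the output. A permutation starts in the input, whose elements are taken in order from left to right. Legal moves: move the next input element onto the top of stack $1$; for $1\le k<s$ move the top of stack $k$ onto the top of stack $k+1$; move the top of stack $s$ to the output. Moves into stacks are legal only if every stack remains increasing from top to bottom (smallest on top). A permutation is sortable by $s$ stacks in series if some sequence of legal moves transfers all elements to the output in the order $1,2,\dots$ (the identity permutation). -}

module Defs where

open import Data.Nat using (ℕ; zero; suc; _<_)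
open import Data.List using (List; []; _∷_; _++_; [_]; map; upTo; length; take; drop)
open import Data.List.Relation.Unary.All using (All)
open import Data.Vec using (Vec; replicate; lookup; _[_]≔_)
open import Data.Fin using (Fin; inject₁; suc; zero; fromℕ)
open import Relation.Binary.PropositionalEquality using (_≡_)
open import Relation.Binary.Construct.Closure.ReflexiveTransitive using (Star)
open import Data.List.Relation.Binary.Permutation.Propositional using (_↭_)
open import Data.Product using (_×_)

oneTo : ℕ → List ℕ
oneTo n = map suc (upTo n)

IsPerm : ℕ → List ℕ → Set
IsPerm n p = p ↭ oneTo n

-- A configuration of s stacks in series:
--   remaining input (next element is the head),
--   the s stacks (stack k is index k-1; the head of each list is the top),
--   the output produced so far (in order of arrival).
record Config (s : ℕ) : Set where
  constructor config
  field
    input  : List ℕ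
    stacks : Vec (List ℕ) s
    output : List ℕ

-- x may be pushed onto stack st iff the stack stays increasing from top to
-- bottom, i.e. x is smaller than every element currently on it.
CanPush : ℕ → List ℕ → Set
CanPush x st = All (x <_) st

data Step {s : ℕ} : Config (suc s) → Config (suc s) → Set where
  fromInput : ∀ {x inp stks out} →
    CanPush x (lookup stks zero) →
    Step (config (x ∷ inp) stks out)
         (config inp (stks [ zero ]≔ (x ∷ lookup stks zero)) out)
  -- stack k → stack k+1  (k = inject₁ i, k+1 = suc i)
  between : ∀ {inp stks out x rest} (i : Fin s) →
    lookup stks (inject₁ i) ≡ x ∷ rest →
    CanPush x (lookup stks (suc i)) →
    Step (config inp stks out)
         (config inp ((stks [ inject₁ i ]≔ rest) [ suc i ]≔ (x ∷ lookup stks (suc i))) out)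
  toOutput : ∀ {inp stks out x rest} →
    lookup stks (fromℕ s) ≡ x ∷ rest →
    Step (config inp stks out)
         (config inp (stks [ fromℕ s ]≔ rest) (out ++ [ x ]))

-- With zero stacks the
-- input goes straight to the output, so only the identity is sortable
-- (this case is never used by the theorem, where s ≥ 1).
SortableBy : (s : ℕ) → List ℕ → Set
SortableBy zero    p = p ≡ oneTo (length p)
SortableBy (suc s) p =
  Star Step (config p (replicate (suc s) []) [])
            (config [] (replicate (suc s) []) (oneTo (length p)))

insertAt : ℕ → ℕ → List ℕ → List ℕ
insertAt i x p = take i p ++ x ∷ drop i p

{-# OPTIONS --safe #-}
-- When n arrives it is pushed onto stack 1.  Being larger than everything
-- else, it then stays at the bottom of stack 1 while every later element is
-- pushed on top of it and immediately moved on to stack 2; elements arriving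
-- before n pass through the empty stack 1 in the same way.  Hence stacks
-- 2, …, t can replay any sorting of p by t − 1 stacks, after which n is the
-- only element left and travels through the remaining stacks to the output.
module Submission where

open import Defs
open import Data.Nat using (ℕ; suc; zero; _≤_; _∸_; _<_; s≤s)
open import Data.List using (List; []; _∷_; _++_; [_]; map; upTo; length)
open import Data.List.Properties using (map-++; upTo-∷ʳ; length-map; length-upTo)
open import Data.List.Relation.Unary.All as All using (All; []; _∷_)
open import Data.List.Relation.Unary.All.Properties using (all-upTo; map⁺)
open import Data.List.Relation.Binary.Permutation.Propositional using (↭-sym)
open import Data.List.Relation.Binary.Permutation.Propositional.Properties using (All-resp-↭; ↭-length)
open import Data.Vec using (replicate) renaming (_∷_ to _∷v_)
open import Data.Fin using (zero; suc)
open import Relation.Binary.PropositionalEquality using (_≡_; refl; sym; cong; subst; module ≡-Reasoning)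
open import Relation.Binary.Construct.Closure.ReflexiveTransitive using (Star; ε; _◅_; _◅◅_)
open import Data.Product using (_×_; _,_)

oneTo-∷ʳ : ∀ m → oneTo m ++ [ suc m ] ≡ oneTo (suc m)
oneTo-∷ʳ m = begin
  map suc (upTo m) ++ map suc [ m ] ≡⟨ sym (map-++ suc (upTo m) [ m ]) ⟩
  map suc (upTo m ++ [ m ])         ≡⟨ cong (map suc) (upTo-∷ʳ m) ⟩
  map suc (upTo (suc m))            ∎
  where open ≡-Reasoning

length-oneTo : ∀ m → length (oneTo m) ≡ m
length-oneTo m = begin
  length (map suc (upTo m)) ≡⟨ length-map suc (upTo m) ⟩
  length (upTo m)           ≡⟨ length-upTo m ⟩
  m                         ∎
  where open ≡-Reasoning

all-oneTo : ∀ m → All (_< suc m) (oneTo m)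
all-oneTo m = map⁺ (All.map s≤s (all-upTo m))

length-insertAt : ∀ i (x : ℕ) p → length (insertAt i x p) ≡ suc (length p)
length-insertAt zero    x p       = refl
length-insertAt (suc i) x []      = refl
length-insertAt (suc i) x (y ∷ p) = cong suc (length-insertAt i x p)

prependStack : ∀ {s} → List ℕ → Config s → Config (suc s)
prependStack h (config inp stks out) = config inp (h ∷v stks) out

Pushable : List ℕ → List ℕ → Set
Pushable h inp = All (λ x → CanPush x h) inp

prependStack-Step : ∀ {s} h {c c′ : Config (suc s)} → Pushable h (Config.input c) → Step c c′ →
  Star Step (prependStack h c) (prependStack h c′) × Pushable h (Config.input c′)
prependStack-Step h (x<h ∷ pushable) (fromInput x<top) =
  fromInput x<h ◅ between zero refl x<top ◅ ε , pushable
prependStack-Step h pushable (between i top≡x∷rest x<next) =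
  between (suc i) top≡x∷rest x<next ◅ ε , pushable
prependStack-Step h pushable (toOutput top≡x∷rest) =
  toOutput top≡x∷rest ◅ ε , pushable

prependStack-Star : ∀ {s} h {c c′ : Config (suc s)} → Pushable h (Config.input c) → Star Step c c′ →
  Star Step (prependStack h c) (prependStack h c′)
prependStack-Star h pushable ε = ε
prependStack-Star h pushable (step ◅ steps) with prependStack-Step h pushable step
... | lifted , pushable′ = lifted ◅◅ prependStack-Star h pushable′ steps

singleton-toOutput : ∀ s (x : ℕ) out →
  Star (Step {s}) (config [] ([ x ] ∷v replicate s []) out)
                  (config [] (replicate (suc s) []) (out ++ [ x ]))
singleton-toOutput zero    x out = toOutput refl ◅ ε
singleton-toOutput (suc s) x out =
  between zero refl [] ◅ prependStack-Star [] [] (singleton-toOutput s x out)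

-- Any position past the end of the input behaves like insertion at the end,
-- so no bound on j is needed.
insertAt-prependStack : ∀ {s} n j {inp stks out e o} →
  All (_< n) inp → Star (Step {s}) (config inp stks out) (config [] e o) →
  Star Step (config (insertAt j n inp) ([] ∷v stks) out) (config [] ([ n ] ∷v e) o)
insertAt-prependStack n zero below steps =
  fromInput [] ◅ prependStack-Star [ n ] (All.map (_∷ []) below) steps
insertAt-prependStack n (suc j) below ε = fromInput [] ◅ ε
insertAt-prependStack n (suc j) (_ ∷ below) (fromInput x<top ◅ steps) =
  fromInput [] ◅ between zero refl x<top ◅ insertAt-prependStack n j below steps
insertAt-prependStack n (suc j) below (between i top≡x∷rest x<next ◅ steps) =
  between (suc i) top≡x∷rest x<next ◅ insertAt-prependStack n (suc j) below steps
insertAt-prependStack n (suc j) below (toOutput top≡x∷rest ◅ steps) =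
  toOutput top≡x∷rest ◅ insertAt-prependStack n (suc j) below steps

sortable-insertAt-suc-length : ∀ s p i → All (_< suc (length p)) p → SortableBy (suc s) p →
  SortableBy (suc (suc s)) (insertAt i (suc (length p)) p)
sortable-insertAt-suc-length s p i below sortable = subst (Star Step _) sortedOutput
  (insertAt-prependStack n i below sortable ◅◅ singleton-toOutput (suc s) n (oneTo (length p)))
  where
  n = suc (length p)
  sortedOutput : config [] (replicate (suc (suc s)) []) (oneTo (length p) ++ [ n ])
               ≡ config [] (replicate (suc (suc s)) []) (oneTo (length (insertAt i n p)))
  sortedOutput = cong (config [] _) (begin
    oneTo (length p) ++ [ n ]       ≡⟨ oneTo-∷ʳ (length p) ⟩
    oneTo n                         ≡⟨ cong oneTo (sym (length-insertAt i n p)) ⟩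
    oneTo (length (insertAt i n p)) ∎)
    where open ≡-Reasoning

mainTheorem4 : (t n : ℕ) → 2 ≤ t → 1 ≤ n → (p : List ℕ) → IsPerm (n ∸ 1) p →
    SortableBy (t ∸ 1) p →
    (i : ℕ) → i ≤ n ∸ 1 → SortableBy t (insertAt i n p)
mainTheorem4 (suc (suc s)) (suc m) (s≤s (s≤s _)) (s≤s _) p perm sortable i _ =
  subst (λ k → SortableBy (suc (suc s)) (insertAt i (suc k) p)) length-p
        (sortable-insertAt-suc-length s p i below sortable)
  where
  length-p : length p ≡ m
  length-p = subst (length p ≡_) (length-oneTo m) (↭-length perm)
  below : All (_< suc (length p)) p
  below = subst (λ k → All (_< suc k) p) (sym length-p) (All-resp-↭ (↭-sym perm) (all-oneTo m))
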